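{- For all conditional formulas $\phi,\psi$: (1) $\phi\mathbin{\Box\!\!\to}\psi\in\mathsf{CnCK}$ if and only if $\psi\in\mathsf{CnCK}$; (2) $\phi\mathbin{\Diamond\!\!\to}\psi\notin\mathsf{CnCK}$.
   Context: Conditional formulas are built from propositional letters with $\wedge,\vee,\to$, $\sim$ (strong negation), and binary $\mathbin{\Box\!\!\to}$, $\mathbin{\Diamond\!\!\to}$. A conditional Fischer-Servi model is $(W,\leq,R,V^+,V^-)$, $W\neq\emptyset$, $\leq$ a preorder, $R\subseteq W\times(\mathcal{P}(W))^2\times W$, $V^\pm$ maps letters to $\leq$-upward closed sets, such that for all $X,Y\subseteq W$, $R_{(X,Y)}=\{(w,v)\mid R(w,(X,Y),v)\}$ satisfies (c1) $w\leq w'$, $wR_{(X,Y)}v$ imply $w'R_{(X,Y)}v'$, $v\leq v'$ for some $v'$; (c2) $wR_{(X,Y)}v$, $v\leq v'$ imply $w\leq w'$, $w'R_{(X,Y)}v'$ for some $w'$. Satisfaction: $w\models^\pm p$ iff $w\in V^\pm(p)$; $\wedge$: $+$ iff both $+$, $-$ iff some $-$; $\vee$: $+$ iff some $+$, $-$ iff both $-$; $w\models^\pm\sim\psi$ iff $w\models^\mp\psi$; $w\models^+\psi\to\chi$ iff $\forall v\geq w(v\models^+\psi\Rightarrow v\models^+\chi)$; $w\models^-\psi\to\chi$ iff $\forall v\geq w(v\models^+\psi\Rightarrow v\models^-\chi)$; with $\|\psi\|=(\{w\mid w\models^+\psi\},\{w\mid w\models^-\psi\})$: $w\models^\pm\psi\mathbin{\Box\!\!\to}\chi$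 iff $\forall v\geq w\,\forall u(vR_{\|\psi\|}u\Rightarrow u\models^\pm\chi)$; $w\models^\pm\psi\mathbin{\Diamond\!\!\to}\chi$ iff $\exists u(wR_{\|\psi\|}u$ and $u\models^\pm\chi)$. $\phi\in\mathsf{CnCK}$ iff $\phi$ is verified at every world of every such model. -}

module Defs where

open import Data.Nat using (ℕ)
open import Data.Product using (Σ; _×_; _,_)
open import Data.Sum using (_⊎_)

infixr 6 _∧_
infixr 5 _∨_
infixr 4 _⇒_ _□→_ _◇→_

data Formula : Set where
  atom : ℕ → Formula
  _∧_ _∨_ _⇒_ _□→_ _◇→_ : Formula → Formula → Formula
  ∼_ : Formula → Formula

_≐_ : {W : Set} → (W → Set) → (W → Set) → Set
X ≐ Y = ∀ w → (X w → Y w) × (Y w → X w)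

record Model : Set₁ where
  field
    W      : Set
    inhab  : W
    _≤_    : W → W → Set
    ≤-refl : ∀ {w} → w ≤ w
    ≤-trans : ∀ {u v w} → u ≤ v → v ≤ w → u ≤ w
    R      : W → (W → Set) → (W → Set) → W → Set
    -- R depends on (X,Y) only as subsets (extensionally)
    R-ext  : ∀ {w v X X′ Y Y′} → X ≐ X′ → Y ≐ Y′ → R w X Y v → R w X′ Y′ v
    V⁺ V⁻  : ℕ → W → Set
    V⁺-up  : ∀ p {w w′} → w ≤ w′ → V⁺ p w → V⁺ p w′
    V⁻-up  : ∀ p {w w′} → w ≤ w′ → V⁻ p w → V⁻ p w′
    c1     : ∀ X Y {w w′ v} → w ≤ w′ → R w X Y v →
             Σ W (λ v′ → R w′ X Y v′ × v ≤ v′)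
    c2     : ∀ X Y {w v v′} → R w X Y v → v ≤ v′ →
             Σ W (λ w′ → w ≤ w′ × R w′ X Y v′)

data Pol : Set where
  pos neg : Pol

flipPol : Pol → Pol
flipPol pos = neg
flipPol neg = pos

module _ (M : Model) where
  open Model M

  -- sat pos w φ : w ⊨⁺ φ ;  sat neg w φ : w ⊨⁻ φ
  sat : Pol → W → Formula → Set
  sat pos w (atom p) = V⁺ p w
  sat neg w (atom p) = V⁻ p w
  sat pos w (φ ∧ ψ) = sat pos w φ × sat pos w ψ
  sat neg w (φ ∧ ψ) = sat neg w φ ⊎ sat neg w ψ
  sat pos w (φ ∨ ψ) = sat pos w φ ⊎ sat pos w ψ
  sat neg w (φ ∨ ψ) = sat neg w φ × sat neg w ψ
  sat s w (∼ φ) = sat (flipPol s) w φ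
  sat pos w (φ ⇒ ψ) = ∀ v → w ≤ v → sat pos v φ → sat pos v ψ
  sat neg w (φ ⇒ ψ) = ∀ v → w ≤ v → sat pos v φ → sat neg v ψ
  sat s w (φ □→ ψ) =
    ∀ v → w ≤ v → ∀ u → R v (λ x → sat pos x φ) (λ x → sat neg x φ) u → sat s u ψ
  sat s w (φ ◇→ ψ) =
    Σ W (λ u → R w (λ x → sat pos x φ) (λ x → sat neg x φ) u × sat s u ψ)

CnCK : Formula → Set₁
CnCK φ = ∀ (M : Model) (w : Model.W M) → sat M pos w φ

-- Validity of ψ gives validity of φ □→ ψ since □→ only inspects worlds
-- of the same model. Conversely, to read ψ off at a world w₀ of a model M,
-- adjoin a fresh world ∗, incomparable with the old ones, whose successors
-- under every antecedent are the worlds above w₀. The old worlds form a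
-- generated submodel, so their satisfaction relation is unchanged, and
-- φ □→ ψ at ∗ yields ψ at w₀. Finally, φ ◇→ ψ fails in any model whose
-- accessibility relation is empty.
module Submission where

open import Defs
open import Data.Empty using (⊥)
open import Data.Nat using (ℕ)
open import Data.Product using (_×_; _,_; Σ)
import Data.Product as Prod
import Data.Sum as Sum
open import Data.Unit using (⊤; tt)
open import Function.Bundles using (_⇔_; mk⇔)
open import Relation.Nullary using (¬_)

≐-sym : {W : Set} {X Y : W → Set} → X ≐ Y → Y ≐ X
≐-sym X≐Y w = Prod.swap (X≐Y w)

module Spectator (M : Model) (w₀ : Model.W M) where
  open Model M

  data W⁺ : Set where
    ∗   : W⁺
    ⌜_⌝ : W → W⁺

  _≤⁺_ : W⁺ → W⁺ → Set
  ∗     ≤⁺ ∗     = ⊤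
  ⌜ v ⌝ ≤⁺ ⌜ u ⌝ = v ≤ u
  _     ≤⁺ _     = ⊥

  ≤⁺-refl : ∀ {v} → v ≤⁺ v
  ≤⁺-refl {∗}     = tt
  ≤⁺-refl {⌜ _ ⌝} = ≤-refl

  ≤⁺-trans : ∀ {u v w} → u ≤⁺ v → v ≤⁺ w → u ≤⁺ w
  ≤⁺-trans {∗}     {∗}     {∗}     _ _ = tt
  ≤⁺-trans {⌜ _ ⌝} {⌜ _ ⌝} {⌜ _ ⌝} p q = ≤-trans p q

  R⁺ : W⁺ → (W⁺ → Set) → (W⁺ → Set) → W⁺ → Set
  R⁺ ∗     X Y ⌜ u ⌝ = w₀ ≤ u
  R⁺ ⌜ v ⌝ X Y ⌜ u ⌝ = R v (λ x → X ⌜ x ⌝) (λ x → Y ⌜ x ⌝) u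
  R⁺ _     X Y ∗     = ⊥

  R⁺-ext : ∀ {w v X X′ Y Y′} → X ≐ X′ → Y ≐ Y′ → R⁺ w X Y v → R⁺ w X′ Y′ v
  R⁺-ext {∗}     {⌜ _ ⌝} _   _   r = r
  R⁺-ext {⌜ _ ⌝} {⌜ _ ⌝} X≐X′ Y≐Y′ r = R-ext (λ x → X≐X′ ⌜ x ⌝) (λ x → Y≐Y′ ⌜ x ⌝) r

  V⁺⁺ V⁻⁺ : ℕ → W⁺ → Set
  V⁺⁺ p ∗     = ⊥
  V⁺⁺ p ⌜ v ⌝ = V⁺ p v
  V⁻⁺ p ∗     = ⊥
  V⁻⁺ p ⌜ v ⌝ = V⁻ p v

  V⁺⁺-up : ∀ p {w w′} → w ≤⁺ w′ → V⁺⁺ p w → V⁺⁺ p w′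
  V⁺⁺-up p {⌜ _ ⌝} {⌜ _ ⌝} = V⁺-up p

  V⁻⁺-up : ∀ p {w w′} → w ≤⁺ w′ → V⁻⁺ p w → V⁻⁺ p w′
  V⁻⁺-up p {⌜ _ ⌝} {⌜ _ ⌝} = V⁻-up p

  c1⁺ : ∀ X Y {w w′ v} → w ≤⁺ w′ → R⁺ w X Y v → Σ W⁺ (λ v′ → R⁺ w′ X Y v′ × v ≤⁺ v′)
  c1⁺ X Y {∗}     {∗}      {⌜ v ⌝} _   r = ⌜ v ⌝ , r , ≤-refl
  c1⁺ X Y {⌜ _ ⌝} {⌜ _ ⌝}  {⌜ _ ⌝} w≤w′ r with c1 _ _ w≤w′ r
  ... | v′ , r′ , v≤v′ = ⌜ v′ ⌝ , r′ , v≤v′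

  c2⁺ : ∀ X Y {w v v′} → R⁺ w X Y v → v ≤⁺ v′ → Σ W⁺ (λ w′ → w ≤⁺ w′ × R⁺ w′ X Y v′)
  c2⁺ X Y {∗}     {⌜ _ ⌝} {⌜ _ ⌝} r v≤v′ = ∗ , tt , ≤-trans r v≤v′
  c2⁺ X Y {⌜ _ ⌝} {⌜ _ ⌝} {⌜ _ ⌝} r v≤v′ with c2 _ _ r v≤v′
  ... | w′ , w≤w′ , r′ = ⌜ w′ ⌝ , w≤w′ , r′

  M⁺ : Model
  M⁺ = record
    { W = W⁺ ; inhab = ∗
    ; _≤_ = _≤⁺_ ; ≤-refl = λ {v} → ≤⁺-refl {v} ; ≤-trans = λ {u} {v} {w} → ≤⁺-trans {u} {v} {w}
    ; R = R⁺ ; R-ext = λ {w} {v} → R⁺-ext {w} {v}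
    ; V⁺ = V⁺⁺ ; V⁻ = V⁻⁺ ; V⁺-up = V⁺⁺-up ; V⁻-up = V⁻⁺-up
    ; c1 = c1⁺ ; c2 = c2⁺ }

  mutual
    sat-lower : ∀ s w φ → sat M⁺ s ⌜ w ⌝ φ → sat M s w φ
    sat-lower pos w (atom p) = λ h → h
    sat-lower neg w (atom p) = λ h → h
    sat-lower pos w (φ ∧ ψ) = Prod.map (sat-lower pos w φ) (sat-lower pos w ψ)
    sat-lower neg w (φ ∧ ψ) = Sum.map (sat-lower neg w φ) (sat-lower neg w ψ)
    sat-lower pos w (φ ∨ ψ) = Sum.map (sat-lower pos w φ) (sat-lower pos w ψ)
    sat-lower neg w (φ ∨ ψ) = Prod.map (sat-lower neg w φ) (sat-lower neg w ψ)
    sat-lower pos w (∼ φ) = sat-lower neg w φ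
    sat-lower neg w (∼ φ) = sat-lower pos w φ
    sat-lower pos w (φ ⇒ ψ) h v w≤v a = sat-lower pos v ψ (h ⌜ v ⌝ w≤v (sat-lift pos v φ a))
    sat-lower neg w (φ ⇒ ψ) h v w≤v a = sat-lower neg v ψ (h ⌜ v ⌝ w≤v (sat-lift pos v φ a))
    sat-lower pos w (φ □→ ψ) h v w≤v u r = sat-lower pos u ψ (h ⌜ v ⌝ w≤v ⌜ u ⌝ (R-lift φ r))
    sat-lower neg w (φ □→ ψ) h v w≤v u r = sat-lower neg u ψ (h ⌜ v ⌝ w≤v ⌜ u ⌝ (R-lift φ r))
    sat-lower pos w (φ ◇→ ψ) (⌜ u ⌝ , r , h) = u , R-lower φ r , sat-lower pos u ψ h
    sat-lower neg w (φ ◇→ ψ) (⌜ u ⌝ , r , h) = u , R-lower φ r , sat-lower neg u ψ h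

    sat-lift : ∀ s w φ → sat M s w φ → sat M⁺ s ⌜ w ⌝ φ
    sat-lift pos w (atom p) = λ h → h
    sat-lift neg w (atom p) = λ h → h
    sat-lift pos w (φ ∧ ψ) = Prod.map (sat-lift pos w φ) (sat-lift pos w ψ)
    sat-lift neg w (φ ∧ ψ) = Sum.map (sat-lift neg w φ) (sat-lift neg w ψ)
    sat-lift pos w (φ ∨ ψ) = Sum.map (sat-lift pos w φ) (sat-lift pos w ψ)
    sat-lift neg w (φ ∨ ψ) = Prod.map (sat-lift neg w φ) (sat-lift neg w ψ)
    sat-lift pos w (∼ φ) = sat-lift neg w φ
    sat-lift neg w (∼ φ) = sat-lift pos w φ
    sat-lift pos w (φ ⇒ ψ) h ⌜ v ⌝ w≤v a = sat-lift pos v ψ (h v w≤v (sat-lower pos v φ a))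
    sat-lift neg w (φ ⇒ ψ) h ⌜ v ⌝ w≤v a = sat-lift neg v ψ (h v w≤v (sat-lower pos v φ a))
    sat-lift pos w (φ □→ ψ) h ⌜ v ⌝ w≤v ⌜ u ⌝ r = sat-lift pos u ψ (h v w≤v u (R-lower φ r))
    sat-lift neg w (φ □→ ψ) h ⌜ v ⌝ w≤v ⌜ u ⌝ r = sat-lift neg u ψ (h v w≤v u (R-lower φ r))
    sat-lift pos w (φ ◇→ ψ) (u , r , h) = ⌜ u ⌝ , R-lift φ r , sat-lift pos u ψ h
    sat-lift neg w (φ ◇→ ψ) (u , r , h) = ⌜ u ⌝ , R-lift φ r , sat-lift neg u ψ h

    truth-set-agrees : ∀ s φ → (λ w → sat M⁺ s ⌜ w ⌝ φ) ≐ (λ w → sat M s w φ)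
    truth-set-agrees s φ w = sat-lower s w φ , sat-lift s w φ

    R-lower : ∀ φ {v u} → R⁺ ⌜ v ⌝ (λ x → sat M⁺ pos x φ) (λ x → sat M⁺ neg x φ) ⌜ u ⌝ →
              R v (λ x → sat M pos x φ) (λ x → sat M neg x φ) u
    R-lower φ = R-ext (truth-set-agrees pos φ) (truth-set-agrees neg φ)

    R-lift : ∀ φ {v u} → R v (λ x → sat M pos x φ) (λ x → sat M neg x φ) u →
             R⁺ ⌜ v ⌝ (λ x → sat M⁺ pos x φ) (λ x → sat M⁺ neg x φ) ⌜ u ⌝
    R-lift φ = R-ext (≐-sym (truth-set-agrees pos φ)) (≐-sym (truth-set-agrees neg φ))

  □→-at-∗ : ∀ φ ψ → sat M⁺ pos ∗ (φ □→ ψ) → sat M pos w₀ ψ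
  □→-at-∗ φ ψ h = sat-lower pos w₀ ψ (h ∗ tt ⌜ w₀ ⌝ ≤-refl)

open Spectator using (M⁺; ∗; □→-at-∗)

noAccessModel : Model
noAccessModel = record
  { W = ⊤ ; inhab = tt ; _≤_ = λ _ _ → ⊤ ; ≤-refl = tt ; ≤-trans = λ _ _ → tt
  ; R = λ _ _ _ _ → ⊥ ; R-ext = λ _ _ r → r ; V⁺ = λ _ _ → ⊤ ; V⁻ = λ _ _ → ⊤
  ; V⁺-up = λ _ _ h → h ; V⁻-up = λ _ _ h → h
  ; c1 = λ _ _ _ () ; c2 = λ _ _ () }

◇→-fails-without-access : ∀ φ ψ → ¬ sat noAccessModel pos tt (φ ◇→ ψ)
◇→-fails-without-access φ ψ (_ , () , _)

lemma5p19 : ∀ (φ ψ : Formula) →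
    ((CnCK (φ □→ ψ) ⇔ CnCK ψ) × (¬ CnCK (φ ◇→ ψ)))
lemma5p19 φ ψ = mk⇔ valid-consequent valid-□→ , ◇→-not-valid
  where
  valid-consequent : CnCK (φ □→ ψ) → CnCK ψ
  valid-consequent h M w₀ = □→-at-∗ M w₀ φ ψ (h (M⁺ M w₀) ∗)

  valid-□→ : CnCK ψ → CnCK (φ □→ ψ)
  valid-□→ h M _ _ _ u _ = h M u

  ◇→-not-valid : ¬ CnCK (φ ◇→ ψ)
  ◇→-not-valid h = ◇→-fails-without-access φ ψ (h noAccessModel tt)
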